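{- Let $s,t$ be coprime integers greater than $1$. If $\lambda$ is a partition with $\mathrm{wei}_s(\lambda)<t$ or $\mathrm{wei}_t(\lambda)<s$, then $\lambda$ is $(s,t)$-minimal.
   Context: Partitions. A rim $s$-hook is a connected set of $s$ nodes of the rim of the Young diagram whose removal leaves a partition's diagram. The $s$-core of $\lambda$ is obtained by repeatedly removing rim $s$-hooks until none remain; the $s$-weight $\mathrm{wei}_s(\lambda)$ is the number removed. A partition is $(s,t)$-minimal if there is no partition of smaller size with the same $s$-core and the same $t$-core. -}

module Defs where

open import Data.Nat using (ℕ; zero; suc; _<_; _≤_; _≥_)
open import Data.List using (List; []; _∷_; length)
open import Data.Nat.ListAction using (sum)
open import Data.List.Relation.Unary.All using (All)
open import Data.List.Relation.Unary.Linked using (Linked)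
open import Data.List.Relation.Unary.Unique.Propositional using (Unique)
open import Data.List.Membership.Propositional using (_∈_)
open import Data.Product using (Σ; ∃; ∃-syntax; _×_; _,_; proj₁)
open import Data.Sum using (_⊎_)
open import Relation.Nullary using (¬_)
open import Relation.Binary.PropositionalEquality using (_≡_)

IsPartition : List ℕ → Set
IsPartition xs = Linked _≥_ xs × All (λ x → 0 < x) xs

Partition : Set
Partition = Σ (List ℕ) IsPartition

size : Partition → ℕ
size p = sum (proj₁ p)

-- i-th part (0-indexed), 0 beyond the length
part : List ℕ → ℕ → ℕ
part []       _       = 0
part (x ∷ xs) zero    = x
part (x ∷ xs) (suc i) = part xs i

-- Nodes of the Young diagram: (row i, column j), 0-indexed
Node : Set
Node = ℕ × ℕ

InDiagram : Partition → Node → Set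
InDiagram p (i , j) = j < part (proj₁ p) i

InRim : Partition → Node → Set
InRim p (i , j) = InDiagram p (i , j) × ¬ InDiagram p (suc i , suc j)

Adjacent : Node → Node → Set
Adjacent (i , j) (i' , j') =
  (i ≡ i' × (suc j ≡ j' ⊎ suc j' ≡ j)) ⊎ (j ≡ j' × (suc i ≡ i' ⊎ suc i' ≡ i))

data PathIn (H : List Node) : Node → Node → Set where
  here : ∀ {c} → PathIn H c c
  step : ∀ {c c' d} → Adjacent c c' → c' ∈ H → PathIn H c' d → PathIn H c d

Connected : List Node → Set
Connected H = ∀ {c d} → c ∈ H → d ∈ H → PathIn H c d

RemoveRimHook : ℕ → Partition → Partition → Set
RemoveRimHook s lam mu =
  Σ (List Node) λ H →
    Unique H × length H ≡ s × All (InRim lam) H × Connected H ×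
    (∀ c → (InDiagram mu c → InDiagram lam c × ¬ c ∈ H) ×
           (InDiagram lam c × ¬ c ∈ H → InDiagram mu c))

data RemoveHooks (s : ℕ) : Partition → Partition → ℕ → Set where
  done : ∀ {lam} → RemoveHooks s lam lam 0
  next : ∀ {lam mu kap k} → RemoveRimHook s lam mu → RemoveHooks s mu kap k →
         RemoveHooks s lam kap (suc k)

HasNoRimHook : ℕ → Partition → Set
HasNoRimHook s kap = ¬ (Σ Partition λ mu → RemoveRimHook s kap mu)

CoreWeight : ℕ → Partition → Partition → ℕ → Set
CoreWeight s lam kap w = RemoveHooks s lam kap w × HasNoRimHook s kap

SameCore : ℕ → Partition → Partition → Set
SameCore s lam mu =
  Σ Partition λ kap → (∃[ w ] CoreWeight s lam kap w) × (∃[ w ] CoreWeight s mu kap w)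

WeightLess : ℕ → Partition → ℕ → Set
WeightLess s lam b = Σ Partition λ kap → ∃[ w ] (CoreWeight s lam kap w × w < b)

Minimal : ℕ → ℕ → Partition → Set
Minimal s t lam =
  ¬ (Σ Partition λ mu → SameCore s lam mu × SameCore t lam mu × size mu < size lam)

module Submission where

-- Record a partition with at most N parts by its β-numbers λ i + (N - 1 - i), read as beads on an
-- abacus with s runners. Removing a rim s-hook is exactly moving one bead from a position x to an
-- empty position x - s. Such a move lowers by one the number Ψ of pairs (gap, bead) on a common
-- runner with the gap below the bead, and whenever Ψ > 0 such a move is available. Hence every
-- sequence of hook removals ending in an s-core has length Ψ(λ): the s-weight is well defined and
-- |λ| = |core| + s wei_s(λ). If μ has the same s- and t-cores as λ and |μ| < |λ|, then |λ| - |μ| is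
-- a positive common multiple of the coprime s and t, which forces wei_s(λ) ≥ t and wei_t(λ) ≥ s.

open import Defs
open import Data.Bool using (Bool; true; false; if_then_else_)
open import Data.Bool.Properties using (⇔→≡)
open import Function.Base using (case_of_)
open import Function.Bundles using (_⇔_; mk⇔)
open import Data.Empty using (⊥; ⊥-elim)
open import Data.Nat
  using (ℕ; zero; suc; pred; _+_; _*_; _∸_; _≤_; _≥_; _<_; z≤n; s≤s; z<s; _≟_; _≤?_; _<?_; NonZero; >-nonZero; >-nonZero⁻¹)
open import Data.Nat.DivMod using (_%_; _/_; m%n<n; m<n⇒m%n≡m; m≡m%n+[m/n]*n; [m+kn]%n≡m%n)
open import Data.Nat.Properties
open import Data.Nat.Tactic.RingSolver using (solve-∀)
open import Data.Nat.Coprimality as Coprimality using (Coprime; coprime-divisor)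
open import Data.Nat.Divisibility using (divides; ∣⇒≤)
open import Data.Product using (∃; _×_; _,_; proj₁; proj₂; uncurry)
open import Data.List using (List; []; _∷_; length; _++_)
open import Data.List.Properties using (length-++)
open import Data.List.Membership.Propositional using (_∈_)
open import Data.List.Membership.Propositional.Properties using (∈-++⁺ˡ; ∈-++⁺ʳ; ∈-++⁻)
open import Data.List.Relation.Unary.Any using (here; there)
import Data.List.Relation.Unary.All as All
open import Data.List.Relation.Unary.Unique.Propositional using (Unique)
open import Data.List.Relation.Unary.AllPairs using ([]; _∷_)
import Data.List.Relation.Unary.Unique.Propositional.Properties as Unique
open import Data.List.Membership.Propositional.Properties.WithK using (unique∧set⇒bag)
open import Data.List.Relation.Binary.BagAndSetEquality using (∼bag⇒↭)
open import Data.List.Relation.Binary.Permutation.Propositional.Properties using (↭-length)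
open import Data.Product.Properties using (≡-dec)
open import Data.List.Membership.DecPropositional (≡-dec _≟_ _≟_) using (_∈?_)
open import Data.List.Relation.Unary.All using (All; []; _∷_)
open import Data.List.Relation.Unary.Linked using (Linked; []; [-]; _∷_)
open import Data.Nat.ListAction using (sum)
open import Relation.Binary.PropositionalEquality
open import Relation.Nullary using (¬_; Dec; yes; no)
open import Data.Sum using (_⊎_; inj₁; inj₂)
open import Relation.Binary using (tri<; tri≈; tri>)

sumBelow : (ℕ → ℕ) → ℕ → ℕ
sumBelow f zero    = 0
sumBelow f (suc n) = sumBelow f n + f n

sumBelow-cong : ∀ {f g} n → (∀ i → i < n → f i ≡ g i) → sumBelow f n ≡ sumBelow g n
sumBelow-cong zero    f≡g = refl
sumBelow-cong (suc n) f≡g =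
  cong₂ _+_ (sumBelow-cong n (λ i i<n → f≡g i (m<n⇒m<1+n i<n))) (f≡g n ≤-refl)

sumBelow-suc-at : ∀ {f g} n k → k < n → (∀ i → i < n → i ≢ k → f i ≡ g i) →
  f k ≡ suc (g k) → sumBelow f n ≡ suc (sumBelow g n)
sumBelow-suc-at {f} {g} (suc n) k k<1+n f≡g fk with k ≟ n
... | yes refl = trans (cong₂ _+_ (sumBelow-cong n (λ i i<n → f≡g i (m<n⇒m<1+n i<n) (<⇒≢ i<n))) fk)
                       (+-suc (sumBelow g k) (g k))
... | no k≢n = cong₂ _+_
  (sumBelow-suc-at n k (≤∧≢⇒< (≤-pred k<1+n) k≢n) (λ i i<n → f≡g i (m<n⇒m<1+n i<n)) fk)
  (f≡g n ≤-refl (≢-sym k≢n))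

sumBelow-pos : ∀ f n → 0 < sumBelow f n → ∃ λ i → i < n × 0 < f i
sumBelow-pos f (suc n) pos with f n ≟ 0
... | no fn≢0 = n , ≤-refl , n≢0⇒n>0 fn≢0
... | yes fn≡0 with sumBelow-pos f n (subst (0 <_) (trans (cong (sumBelow f n +_) fn≡0) (+-identityʳ _)) pos)
...   | i , i<n , fi>0 = i , m<n⇒m<1+n i<n , fi>0

sumBelow-shift : ∀ f n → sumBelow f (suc n) ≡ f 0 + sumBelow (λ i → f (suc i)) n
sumBelow-shift f zero    = +-comm 0 (f 0)
sumBelow-shift f (suc n) = trans (cong (_+ f (suc n)) (sumBelow-shift f n)) (+-assoc (f 0) _ _)

sumBelow-vanishing : ∀ f {m n} → m ≤ n → (∀ i → m ≤ i → f i ≡ 0) → sumBelow f n ≡ sumBelow f m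
sumBelow-vanishing f {m} m≤n f≡0 with m≤n⇒∃[o]m+o≡n m≤n
... | o , refl = go o
  where
  open ≡-Reasoning
  go : ∀ o → sumBelow f (m + o) ≡ sumBelow f m
  go zero    = cong (sumBelow f) (+-identityʳ m)
  go (suc o) = begin
    sumBelow f (m + suc o)            ≡⟨ cong (sumBelow f) (+-suc m o) ⟩
    sumBelow f (m + o) + f (m + o)    ≡⟨ cong₂ _+_ (go o) (f≡0 (m + o) (m≤m+n m o)) ⟩
    sumBelow f m + 0                  ≡⟨ +-identityʳ _ ⟩
    sumBelow f m                      ∎

sumBelow-∸ : ∀ f g n → (∀ i → g i ≤ f i) → sumBelow f n ≡ sumBelow (λ i → f i ∸ g i) n + sumBelow g n
sumBelow-∸ f g zero    g≤f = refl
sumBelow-∸ f g (suc n) g≤f = begin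
  sumBelow f n + f n                  ≡⟨ cong₂ _+_ (sumBelow-∸ f g n g≤f) (sym (m∸n+n≡m (g≤f n))) ⟩
  (a + b) + (f n ∸ g n + g n)         ≡⟨ interchange a b (f n ∸ g n) (g n) ⟩
  (a + (f n ∸ g n)) + (b + g n)       ∎
  where
  open ≡-Reasoning
  a b : ℕ
  a = sumBelow (λ i → f i ∸ g i) n
  b = sumBelow g n
  interchange : ∀ a b c d → (a + b) + (c + d) ≡ (a + c) + (b + d)
  interchange = solve-∀

module _ {R : ℕ → Set} (R? : ∀ i → Dec (R i)) where

  least-below : ∀ n → (∃ λ m → m < n × R m × (∀ j → j < m → ¬ R j)) ⊎ (∀ j → j < n → ¬ R j)
  least-below zero = inj₂ (λ _ ())
  least-below (suc n) with least-below n
  ... | inj₁ (m , m<n , Rm , m-least) = inj₁ (m , m<n⇒m<1+n m<n , Rm , m-least)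
  ... | inj₂ none<n with R? n
  ...   | yes Rn = inj₁ (n , ≤-refl , Rn , none<n)
  ...   | no ¬Rn = inj₂ λ j j<1+n → case m≤n⇒m<n∨m≡n (≤-pred j<1+n) of λ where
            (inj₁ j<n) → none<n j j<n
            (inj₂ refl) → ¬Rn

  least : ∀ k → R k → ∃ λ m → m ≤ k × R m × (∀ j → j < m → ¬ R j)
  least k Rk with least-below (suc k)
  ... | inj₁ (m , m<1+k , Rm , m-least) = m , ≤-pred m<1+k , Rm , m-least
  ... | inj₂ none≤k = ⊥-elim (none≤k k ≤-refl Rk)

  greatest-below : ∀ n → (∃ λ m → m < n × R m × (∀ j → m < j → j < n → ¬ R j)) ⊎ (∀ j → j < n → ¬ R j)
  greatest-below zero = inj₂ (λ _ ())
  greatest-below (suc n) with R? n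
  ... | yes Rn = inj₁ (n , ≤-refl , Rn , λ j n<j j<1+n → ⊥-elim (<-irrefl refl (<-≤-trans n<j (≤-pred j<1+n))))
  ... | no ¬Rn with greatest-below n
  ...   | inj₁ (m , m<n , Rm , m-greatest) = inj₁ (m , m<n⇒m<1+n m<n , Rm , λ j m<j j<1+n →
            case m≤n⇒m<n∨m≡n (≤-pred j<1+n) of λ where
              (inj₁ j<n) → m-greatest j m<j j<n
              (inj₂ refl) → ¬Rn)
  ...   | inj₂ none<n = inj₂ λ j j<1+n → case m≤n⇒m<n∨m≡n (≤-pred j<1+n) of λ where
            (inj₁ j<n) → none<n j j<n
            (inj₂ refl) → ¬Rn

  greatest : ∀ N → (∀ i → R i → i < N) → ∀ k → R k → ∃ λ m → k ≤ m × R m × (∀ j → m < j → ¬ R j)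
  greatest N R<N k Rk with greatest-below N
  ... | inj₂ none<N = ⊥-elim (none<N k (R<N k Rk) Rk)
  ... | inj₁ (m , m<N , Rm , m-greatest) = m , k≤m , Rm , λ j m<j Rj → m-greatest j m<j (R<N j Rj) Rj
    where
    k≤m : k ≤ m
    k≤m with k ≤? m
    ... | yes k≤m = k≤m
    ... | no k≰m  = ⊥-elim (m-greatest k (≰⇒> k≰m) (R<N k Rk) Rk)

∈-of-length-pos : ∀ {A : Set} (xs : List A) → 0 < length xs → ∃ λ x → x ∈ xs
∈-of-length-pos (x ∷ _) _ = x , here refl

Unique-length-≡ : ∀ {A : Set} {xs ys : List A} → Unique xs → Unique ys → (∀ {z} → z ∈ xs ⇔ z ∈ ys) →
  length xs ≡ length ys
Unique-length-≡ xs! ys! xs⇔ys = ↭-length (∼bag⇒↭ (unique∧set⇒bag xs! ys! xs⇔ys))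

falses : (ℕ → Bool) → ℕ → ℕ
falses f zero    = 0
falses f (suc n) = falses f n + (if f n then 0 else 1)

-- The number of pairs i < j < n with f i = false and f j = true.
inversions : (ℕ → Bool) → ℕ → ℕ
inversions f zero    = 0
inversions f (suc n) = inversions f n + (if f n then falses f n else 0)

inversions-falses-cong : ∀ f g n → (∀ i → i < n → f i ≡ g i) →
  inversions f n ≡ inversions g n × falses f n ≡ falses g n
inversions-falses-cong f g zero    f≡g = refl , refl
inversions-falses-cong f g (suc n) f≡g
  with inversions-falses-cong f g n (λ i i<n → f≡g i (m<n⇒m<1+n i<n)) | f≡g n ≤-refl
... | inv≡ , fal≡ | fn≡gn rewrite fn≡gn | inv≡ | fal≡ = refl , refl

inversions-swap : ∀ f g a n → f a ≡ false → f (suc a) ≡ true → g a ≡ true → g (suc a) ≡ false →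
  (∀ i → i ≢ a → i ≢ suc a → f i ≡ g i) → suc (suc a) ≤ n →
  inversions f n ≡ suc (inversions g n) × falses f n ≡ falses g n
inversions-swap f g a (suc m) fa fa+1 ga ga+1 f≡g le with m ≟ suc a
... | yes refl
  with inversions-falses-cong f g a (λ i i<a → f≡g i (<⇒≢ i<a) (<⇒≢ (m<n⇒m<1+n i<a)))
...   | inv≡ , fal≡ rewrite fa | fa+1 | ga | ga+1 | inv≡ | fal≡ =
        inversions≡ (inversions g a) (falses g a) , falses≡ (falses g a)
  where
  inversions≡ : ∀ i z → i + 0 + (z + 1) ≡ suc (i + z + 0)
  inversions≡ = solve-∀
  falses≡ : ∀ z → z + 1 + 0 ≡ z + 0 + 1
  falses≡ = solve-∀
inversions-swap f g a (suc m) fa fa+1 ga ga+1 f≡g le | no m≢a+1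
  with inversions-swap f g a m fa fa+1 ga ga+1 f≡g (≤∧≢⇒< (≤-pred le) (≢-sym m≢a+1))
... | inv≡ , fal≡ rewrite inv≡ | fal≡ | f≡g m (>⇒≢ (≤-trans (n≤1+n _) (≤∧≢⇒< (≤-pred le) (≢-sym m≢a+1)))) m≢a+1 =
      refl , refl

inversions-pos : ∀ f n → 0 < inversions f n → ∃ λ a → suc a < n × f a ≡ false × f (suc a) ≡ true
inversions-pos f (suc n) pos with inversions f n ≟ 0 | f n in fn
... | no inv≢0 | _ = let (a , a+1<n , fa , fa+1) = inversions-pos f n (n≢0⇒n>0 inv≢0) in
                     a , m<n⇒m<1+n a+1<n , fa , fa+1
... | yes inv≡0 | false = ⊥-elim (<-irrefl (sym (trans (+-identityʳ _) inv≡0)) pos)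
... | yes inv≡0 | true = last-gap n inv≡0 (subst (0 <_) (cong (_+ falses f n) inv≡0) pos) fn
  where
  last-gap : ∀ n → inversions f n ≡ 0 → 0 < falses f n → f n ≡ true →
    ∃ λ a → suc a < suc n × f a ≡ false × f (suc a) ≡ true
  last-gap (suc m) inv≡0 fal>0 fn with f m in fm
  ... | false = m , ≤-refl , fm , fn
  ... | true  = ⊥-elim (<-irrefl (sym inv≡0) (<-≤-trans fal>0 (begin
    falses f m + 0                    ≡⟨ +-identityʳ (falses f m) ⟩
    falses f m                        ≤⟨ m≤n+m (falses f m) (inversions f m) ⟩
    inversions f m + falses f m       ∎)))
    where open ≤-Reasoning

runner-unique : ∀ s .{{_ : NonZero s}} ρ k ρ' k' → ρ < s → ρ' < s →
  ρ + k * s ≡ ρ' + k' * s → ρ ≡ ρ' × k ≡ k'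
runner-unique s ρ k ρ' k' ρ<s ρ'<s e =
  ρ≡ρ' , *-cancelʳ-≡ k k' s (+-cancelˡ-≡ ρ (k * s) (k' * s) (trans e (cong (_+ k' * s) (sym ρ≡ρ'))))
  where
  open ≡-Reasoning
  ρ≡ρ' : ρ ≡ ρ'
  ρ≡ρ' = begin
    ρ                  ≡⟨ m<n⇒m%n≡m ρ<s ⟨
    ρ % s              ≡⟨ [m+kn]%n≡m%n ρ k s ⟨
    (ρ + k * s) % s    ≡⟨ cong (_% s) e ⟩
    (ρ' + k' * s) % s  ≡⟨ [m+kn]%n≡m%n ρ' k' s ⟩
    ρ' % s             ≡⟨ m<n⇒m%n≡m ρ'<s ⟩
    ρ'                 ∎

-- Position ρ + k * s of B is level k of runner ρ of the s-abacus; Ψ counts, on every runner,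
-- the pairs (gap, bead) with the gap below the bead.
Ψ : (s levels : ℕ) → (ℕ → Bool) → ℕ
Ψ s levels B = sumBelow (λ ρ → inversions (λ k → B (ρ + k * s)) levels) s

Ψ-move : ∀ s .{{_ : NonZero s}} levels (B B' : ℕ → Bool) x → s ≤ x → x < levels →
  B x ≡ true → B (x ∸ s) ≡ false → B' x ≡ false → B' (x ∸ s) ≡ true →
  (∀ y → y ≢ x → y ≢ x ∸ s → B y ≡ B' y) → Ψ s levels B ≡ suc (Ψ s levels B')
Ψ-move s levels B B' x s≤x x<levels Bx Bx-s B'x B'x-s B≡B' =
  sumBelow-suc-at s ρ₀ ρ₀<s other-runners moved-runner
  where
  ρ₀ a : ℕ
  ρ₀ = (x ∸ s) % s
  a = (x ∸ s) / s
  ρ₀<s : ρ₀ < s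
  ρ₀<s = m%n<n (x ∸ s) s
  x-s≡ : x ∸ s ≡ ρ₀ + a * s
  x-s≡ = m≡m%n+[m/n]*n (x ∸ s) s
  x≡ : x ≡ ρ₀ + suc a * s
  x≡ = begin
    x                  ≡⟨ m∸n+n≡m s≤x ⟨
    (x ∸ s) + s        ≡⟨ cong (_+ s) x-s≡ ⟩
    ρ₀ + a * s + s     ≡⟨ +-assoc ρ₀ (a * s) s ⟩
    ρ₀ + (a * s + s)   ≡⟨ cong (ρ₀ +_) (+-comm (a * s) s) ⟩
    ρ₀ + suc a * s     ∎
    where open ≡-Reasoning
  other-runners : ∀ ρ → ρ < s → ρ ≢ ρ₀ →
    inversions (λ k → B (ρ + k * s)) levels ≡ inversions (λ k → B' (ρ + k * s)) levels
  other-runners ρ ρ<s ρ≢ρ₀ = proj₁ (inversions-falses-cong _ _ levels λ k _ → B≡B' (ρ + k * s)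
    (λ e → ρ≢ρ₀ (proj₁ (runner-unique s ρ k ρ₀ (suc a) ρ<s ρ₀<s (trans e x≡))))
    (λ e → ρ≢ρ₀ (proj₁ (runner-unique s ρ k ρ₀ a ρ<s ρ₀<s (trans e x-s≡)))))
  a+1<levels : suc a < levels
  a+1<levels = ≤-<-trans (subst (suc a ≤_) (sym x≡) (≤-trans (m≤m*n (suc a) s) (m≤n+m _ ρ₀))) x<levels
  moved-runner : inversions (λ k → B (ρ₀ + k * s)) levels ≡ suc (inversions (λ k → B' (ρ₀ + k * s)) levels)
  moved-runner = proj₁ (inversions-swap _ _ a levels
    (trans (cong B (sym x-s≡)) Bx-s) (trans (cong B (sym x≡)) Bx)
    (trans (cong B' (sym x-s≡)) B'x-s) (trans (cong B' (sym x≡)) B'x)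
    (λ k k≢a k≢a+1 → B≡B' (ρ₀ + k * s)
       (λ e → k≢a+1 (proj₂ (runner-unique s ρ₀ k ρ₀ (suc a) ρ₀<s ρ₀<s (trans e x≡))))
       (λ e → k≢a (proj₂ (runner-unique s ρ₀ k ρ₀ a ρ₀<s ρ₀<s (trans e x-s≡)))))
    a+1<levels)

Ψ-pos : ∀ s .{{_ : NonZero s}} levels (B : ℕ → Bool) → 0 < Ψ s levels B →
  ∃ λ x → s ≤ x × B x ≡ true × B (x ∸ s) ≡ false
Ψ-pos s levels B pos with sumBelow-pos _ s pos
... | ρ , ρ<s , runner-pos with inversions-pos _ levels runner-pos
... | a , _ , gap , bead = ρ + suc a * s , ≤-trans (m≤m+n s (a * s)) (m≤n+m _ ρ) , bead ,
      trans (cong B x-s≡) gap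
  where
  x-s≡ : ρ + suc a * s ∸ s ≡ ρ + a * s
  x-s≡ = begin
    ρ + suc a * s ∸ s      ≡⟨ cong (λ z → ρ + z ∸ s) (+-comm s (a * s)) ⟩
    ρ + (a * s + s) ∸ s    ≡⟨ cong (_∸ s) (+-assoc ρ (a * s) s) ⟨
    ρ + a * s + s ∸ s      ≡⟨ m+n∸n≡m (ρ + a * s) s ⟩
    ρ + a * s              ∎
    where open ≡-Reasoning

part-suc-≤ : ∀ {xs} → Linked _≥_ xs → ∀ i → part xs (suc i) ≤ part xs i
part-suc-≤ []      i       = z≤n
part-suc-≤ [-]     zero    = z≤n
part-suc-≤ [-]     (suc i) = z≤n
part-suc-≤ (x≥y ∷ _) zero  = x≥y
part-suc-≤ (_ ∷ l) (suc i) = part-suc-≤ l i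

antitone : ∀ (f : ℕ → ℕ) → (∀ i → f (suc i) ≤ f i) → ∀ {i k} → i ≤ k → f k ≤ f i
antitone f f-suc {i} i≤k with m≤n⇒∃[o]m+o≡n i≤k
... | o , refl = go o
  where
  go : ∀ o → f (i + o) ≤ f i
  go zero    = ≤-reflexive (cong f (+-identityʳ i))
  go (suc o) = ≤-trans (subst (λ z → f z ≤ f (i + o)) (sym (+-suc i o)) (f-suc (i + o))) (go o)

part-beyond : ∀ xs i → length xs ≤ i → part xs i ≡ 0
part-beyond []       i       _         = refl
part-beyond (x ∷ xs) (suc i) (s≤s len≤i) = part-beyond xs i len≤i

part-pos : ∀ {xs} → All (0 <_) xs → ∀ i → i < length xs → 0 < part xs i
part-pos (x>0 ∷ _)   zero    _          = x>0
part-pos (_ ∷ all>0) (suc i) (s≤s i<len) = part-pos all>0 i i<len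

part-pos⇒<length : ∀ xs i → 0 < part xs i → i < length xs
part-pos⇒<length (x ∷ xs) zero    _   = s≤s z≤n
part-pos⇒<length (x ∷ xs) (suc i) pos = s≤s (part-pos⇒<length xs i pos)

length-mono : ∀ xs ys → (∀ i → part xs i ≤ part ys i) → All (0 <_) xs → length xs ≤ length ys
length-mono xs ys xs≤ys all>0 with length xs ≤? length ys
... | yes len≤ = len≤
... | no len≰ = ⊥-elim (<-irrefl (sym (part-beyond ys (length ys) ≤-refl))
                      (≤-trans (part-pos all>0 (length ys) (≰⇒> len≰)) (xs≤ys (length ys))))

sum≡sumBelow-part : ∀ xs n → length xs ≤ n → sum xs ≡ sumBelow (part xs) n
sum≡sumBelow-part xs n len≤n =
  trans (sum≡ xs) (sym (sumBelow-vanishing (part xs) len≤n (part-beyond xs)))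
  where
  sum≡ : ∀ xs → sum xs ≡ sumBelow (part xs) (length xs)
  sum≡ []       = refl
  sum≡ (x ∷ xs) = sym (trans (sumBelow-shift (part (x ∷ xs)) (length xs)) (cong (x +_) (sym (sum≡ xs))))

positivePrefix : (ℕ → ℕ) → ℕ → List ℕ
positivePrefix f zero = []
positivePrefix f (suc n) with f 0 ≟ 0
... | yes _ = []
... | no _  = f 0 ∷ positivePrefix (λ i → f (suc i)) n

module _ (f : ℕ → ℕ) (n : ℕ) (f-suc : ∀ i → f (suc i) ≤ f i) (f-beyond : ∀ i → n ≤ i → f i ≡ 0) where

  part-positivePrefix : ∀ i → part (positivePrefix f n) i ≡ f i
  part-positivePrefix = go f n f-suc f-beyond
    where
    go : ∀ f n → (∀ i → f (suc i) ≤ f i) → (∀ i → n ≤ i → f i ≡ 0) → ∀ i → part (positivePrefix f n) i ≡ f i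
    go f zero    f-suc f-beyond i = sym (f-beyond i z≤n)
    go f (suc n) f-suc f-beyond i with f 0 ≟ 0
    ... | yes f0≡0 = sym (n≤0⇒n≡0 (subst (f i ≤_) f0≡0 (antitone f f-suc z≤n)))
    ... | no _ with i
    ...   | zero   = refl
    ...   | suc i' = go (λ i → f (suc i)) n (λ i → f-suc (suc i)) (λ i n≤i → f-beyond (suc i) (s≤s n≤i)) i'

  partitionOf : Partition
  partitionOf = positivePrefix f n , linked (positivePrefix f n) decreasing , positive f n
    where
    decreasing : ∀ i → part (positivePrefix f n) (suc i) ≤ part (positivePrefix f n) i
    decreasing i = subst₂ _≤_ (sym (part-positivePrefix (suc i))) (sym (part-positivePrefix i)) (f-suc i)
    linked : ∀ xs → (∀ i → part xs (suc i) ≤ part xs i) → Linked _≥_ xs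
    linked []           _   = []
    linked (x ∷ [])     _   = [-]
    linked (x ∷ y ∷ xs) dec = dec 0 ∷ linked (y ∷ xs) (λ i → dec (suc i))
    positive : ∀ f n → All (0 <_) (positivePrefix f n)
    positive f zero = []
    positive f (suc n) with f 0 ≟ 0
    ... | yes _   = []
    ... | no f0≢0 = n≢0⇒n>0 f0≢0 ∷ positive (λ i → f (suc i)) n

skewSize : (P Q : ℕ → ℕ) → ℕ → ℕ
skewSize P Q N = sumBelow (λ i → P i ∸ Q i) N

size-∸ : ∀ (lam mu : Partition) N → length (proj₁ lam) ≤ N → (∀ i → part (proj₁ mu) i ≤ part (proj₁ lam) i) →
  size lam ≡ size mu + skewSize (part (proj₁ lam)) (part (proj₁ mu)) N
size-∸ (xs , _) (ys , _ , ys>0) N len≤N ys≤xs = begin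
  sum xs                       ≡⟨ sum≡sumBelow-part xs N len≤N ⟩
  sumBelow (part xs) N         ≡⟨ sumBelow-∸ (part xs) (part ys) N ys≤xs ⟩
  D + sumBelow (part ys) N     ≡⟨ +-comm D _ ⟩
  sumBelow (part ys) N + D     ≡⟨ cong (_+ D) (sum≡sumBelow-part ys N (≤-trans (length-mono ys xs ys≤xs ys>0) len≤N)) ⟨
  sum ys + D                   ∎
  where
  open ≡-Reasoning
  D : ℕ
  D = skewSize (part xs) (part ys) N

β : (ℕ → ℕ) → ℕ → ℕ → ℕ
β P N i = P i + (N ∸ suc i)

β-strict : ∀ P N → (∀ i → P (suc i) ≤ P i) → ∀ {i k} → i < k → k < N → β P N k < β P N i
β-strict P N P-suc i<k k<N = +-mono-≤-< (antitone P P-suc (<⇒≤ i<k)) (∸-monoʳ-< (s≤s i<k) k<N)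

β-antitone : ∀ P N → (∀ i → P (suc i) ≤ P i) → ∀ {i k} → i ≤ k → k < N → β P N k ≤ β P N i
β-antitone P N P-suc i≤k k<N with m≤n⇒m<n∨m≡n i≤k
... | inj₁ i<k  = <⇒≤ (β-strict P N P-suc i<k k<N)
... | inj₂ refl = ≤-refl

∸-suc : ∀ N i → suc i < N → N ∸ suc i ≡ suc (N ∸ suc (suc i))
∸-suc (suc N) i (s≤s i+1<N) = +-∸-assoc 1 i+1<N

β-suc : ∀ P N i → suc i < N → β P N i ≡ suc (P i + (N ∸ suc (suc i)))
β-suc P N i i+1<N = trans (cong (P i +_) (∸-suc N i i+1<N)) (+-suc (P i) _)

β-injective : ∀ P N → (∀ i → P (suc i) ≤ P i) → ∀ {i k} → i < N → k < N → β P N i ≡ β P N k → i ≡ k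
β-injective P N P-suc {i} {k} i<N k<N βi≡βk with <-cmp i k
... | tri< i<k _ _ = ⊥-elim (<-irrefl (sym βi≡βk) (β-strict P N P-suc i<k k<N))
... | tri≈ _ i≡k _ = i≡k
... | tri> _ _ k<i = ⊥-elim (<-irrefl βi≡βk (β-strict P N P-suc k<i i<N))

occupied : (ℕ → ℕ) → ℕ → ℕ → Bool
occupied b zero    y = false
occupied b (suc n) y with b n ≟ y
... | yes _ = true
... | no _  = occupied b n y

occupied-intro : ∀ b n y i → i < n → b i ≡ y → occupied b n y ≡ true
occupied-intro b (suc n) y i i<1+n bi≡y with b n ≟ y
... | yes _ = refl
... | no bn≢y with i ≟ n
...   | yes refl = ⊥-elim (bn≢y bi≡y)
...   | no i≢n   = occupied-intro b n y i (≤∧≢⇒< (≤-pred i<1+n) i≢n) bi≡y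

occupied-elim : ∀ b n y → occupied b n y ≡ true → ∃ λ i → i < n × b i ≡ y
occupied-elim b (suc n) y occ with b n ≟ y
... | yes bn≡y = n , ≤-refl , bn≡y
... | no _ with occupied-elim b n y occ
...   | i , i<n , bi≡y = i , m<n⇒m<1+n i<n , bi≡y

occupied-false : ∀ b n y → (∀ i → i < n → b i ≢ y) → occupied b n y ≡ false
occupied-false b n y b≢y with occupied b n y in occ
... | false = refl
... | true with occupied-elim b n y occ
...   | i , i<n , bi≡y = ⊥-elim (b≢y i i<n bi≡y)

occupied-≡ : ∀ b b' n y → (∀ i → i < n → b i ≡ y → ∃ λ i' → i' < n × b' i' ≡ y) →
  (∀ i → i < n → b' i ≡ y → ∃ λ i' → i' < n × b i' ≡ y) → occupied b n y ≡ occupied b' n y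
occupied-≡ b b' n y b⊆b' b'⊆b = ⇔→≡ {z = true} (mk⇔ (transport b b' b⊆b') (transport b' b b'⊆b))
  where
  transport : ∀ b b' → (∀ i → i < n → b i ≡ y → ∃ λ i' → i' < n × b' i' ≡ y) →
    occupied b n y ≡ true → occupied b' n y ≡ true
  transport b b' b⊆b' occ with occupied-elim b n y occ
  ... | i , i<n , bi≡y with b⊆b' i i<n bi≡y
  ...   | i' , i'<n , b'i'≡y = occupied-intro b' n y i' i'<n b'i'≡y

-- The skew shape P / Q is a rim hook in rows top, ..., bottom: consecutive rows share exactly one column.
record HookShape (P Q : ℕ → ℕ) (N : ℕ) : Set where
  field
    top bottom  : ℕ
    top≤bottom  : top ≤ bottom
    bottom<N    : bottom < N
    Q≤P         : ∀ i → Q i ≤ P i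
    Q<P-bottom  : Q bottom < P bottom
    Q≡P-above   : ∀ i → i < top → Q i ≡ P i
    Q≡P-below   : ∀ i → bottom < i → Q i ≡ P i
    joined      : ∀ i → top ≤ i → i < bottom → P (suc i) ≡ suc (Q i)

  rows : ∀ i → Q i < P i → top ≤ i × i ≤ bottom
  rows i Qi<Pi with i <? top | bottom <? i
  ... | yes i<top | _          = ⊥-elim (<-irrefl (Q≡P-above i i<top) Qi<Pi)
  ... | _         | yes bot<i  = ⊥-elim (<-irrefl (Q≡P-below i bot<i) Qi<Pi)
  ... | no i≮top  | no bot≮i   = ≮⇒≥ i≮top , ≮⇒≥ bot≮i

  skewSize-above : ∀ n → n ≤ top → skewSize P Q n ≡ 0
  skewSize-above zero    _     = refl
  skewSize-above (suc n) n<top =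
    trans (cong₂ _+_ (skewSize-above n (≤-trans (n≤1+n n) n<top)) (cong (_∸ Q n) (sym (Q≡P-above n n<top))))
          (n∸n≡0 (Q n))

  telescope-rows : ∀ j → top + j ≤ bottom → skewSize P Q (suc (top + j)) + Q (top + j) ≡ P top + j
  telescope-rows zero _ rewrite +-identityʳ top | skewSize-above top ≤-refl =
    trans (m∸n+n≡m (Q≤P top)) (sym (+-identityʳ (P top)))
  telescope-rows (suc j) top+j<bot = begin
    skewSize P Q (suc (top + suc j)) + Q (top + suc j)  ≡⟨ cong (λ z → skewSize P Q (suc z) + Q z) (+-suc top j) ⟩
    S + (P (suc i) ∸ Q (suc i)) + Q (suc i)              ≡⟨ +-assoc S _ _ ⟩
    S + (P (suc i) ∸ Q (suc i) + Q (suc i))              ≡⟨ cong (S +_) (m∸n+n≡m (Q≤P (suc i))) ⟩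
    S + P (suc i)                                        ≡⟨ cong (S +_) (joined i (m≤m+n top j) i<bot) ⟩
    S + suc (Q i)                                        ≡⟨ +-suc S (Q i) ⟩
    suc (S + Q i)                                        ≡⟨ cong suc (telescope-rows j (<⇒≤ i<bot)) ⟩
    suc (P top + j)                                      ≡⟨ +-suc (P top) j ⟨
    P top + suc j                                        ∎
    where
    open ≡-Reasoning
    i S : ℕ
    i = top + j
    S = skewSize P Q (suc i)
    i<bot : i < bottom
    i<bot = subst (_≤ bottom) (+-suc top j) top+j<bot

  telescope : skewSize P Q N + Q bottom ≡ P top + (bottom ∸ top)
  telescope = begin
    skewSize P Q N + Q bottom           ≡⟨ cong (_+ Q bottom) (sumBelow-vanishing _ bottom<N unchanged-below) ⟩
    skewSize P Q (suc bottom) + Q bottom ≡⟨ subst (λ b → skewSize P Q (suc b) + Q b ≡ P top + (bottom ∸ top))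
                                                 (m+[n∸m]≡n top≤bottom)
                                                 (telescope-rows (bottom ∸ top) (≤-reflexive (m+[n∸m]≡n top≤bottom))) ⟩
    P top + (bottom ∸ top)               ∎
    where
    open ≡-Reasoning
    unchanged-below : ∀ i → suc bottom ≤ i → P i ∸ Q i ≡ 0
    unchanged-below i bot<i = trans (cong (_∸ Q i) (sym (Q≡P-below i bot<i))) (n∸n≡0 (Q i))

  β-moved : β Q N bottom + skewSize P Q N ≡ β P N top
  β-moved = begin
    Q bottom + (N ∸ suc bottom) + skewSize P Q N      ≡⟨ rearrange (Q bottom) (N ∸ suc bottom) (skewSize P Q N) ⟩
    (skewSize P Q N + Q bottom) + (N ∸ suc bottom)    ≡⟨ cong (_+ (N ∸ suc bottom)) telescope ⟩
    P top + (bottom ∸ top) + (N ∸ suc bottom)         ≡⟨ +-assoc (P top) _ _ ⟩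
    P top + ((bottom ∸ top) + (N ∸ suc bottom))       ≡⟨ cong (P top +_) (gaps top≤bottom bottom<N) ⟩
    P top + (N ∸ suc top)                             ∎
    where
    open ≡-Reasoning
    rearrange : ∀ a b c → a + b + c ≡ (c + a) + b
    rearrange = solve-∀
    gaps : ∀ {t b N} → t ≤ b → b < N → (b ∸ t) + (N ∸ suc b) ≡ N ∸ suc t
    gaps {t} t≤b b<N with m≤n⇒∃[o]m+o≡n t≤b | m≤n⇒∃[o]m+o≡n b<N
    ... | k , refl | o , refl = begin
      (t + k ∸ t) + (suc (t + k) + o ∸ suc (t + k))   ≡⟨ cong₂ _+_ (m+n∸m≡n t k) (m+n∸m≡n (suc (t + k)) o) ⟩
      k + o                                          ≡⟨ m+n∸m≡n (suc t) (k + o) ⟨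
      suc t + (k + o) ∸ suc t                        ≡⟨ cong (λ z → suc z ∸ suc t) (+-assoc t k o) ⟨
      suc (t + k) + o ∸ suc t                        ∎

  β-shift : ∀ i → top ≤ i → i < bottom → β Q N i ≡ β P N (suc i)
  β-shift i top≤i i<bot = begin
    Q i + (N ∸ suc i)                  ≡⟨ β-suc Q N i (≤-<-trans i<bot bottom<N) ⟩
    suc (Q i) + (N ∸ suc (suc i))      ≡⟨ cong (_+ (N ∸ suc (suc i))) (joined i top≤i i<bot) ⟨
    P (suc i) + (N ∸ suc (suc i))      ∎
    where open ≡-Reasoning

  β-image-Q : ∀ i → i < N → i ≡ bottom ⊎ ∃ λ j → j < N × j ≢ top × β Q N i ≡ β P N j
  β-image-Q i i<N with <-cmp i top | <-cmp i bottom
  ... | tri< i<top _ _ | _ = inj₂ (i , i<N , <⇒≢ i<top , cong (_+ (N ∸ suc i)) (Q≡P-above i i<top))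
  ... | _ | tri≈ _ i≡bot _ = inj₁ i≡bot
  ... | _ | tri> _ _ bot<i =
    inj₂ (i , i<N , >⇒≢ (≤-<-trans top≤bottom bot<i) , cong (_+ (N ∸ suc i)) (Q≡P-below i bot<i))
  ... | tri≈ _ refl _ | tri< i<bot _ _ = inj₂ (suc i , ≤-<-trans i<bot bottom<N , >⇒≢ ≤-refl , β-shift i ≤-refl i<bot)
  ... | tri> _ _ top<i | tri< i<bot _ _ =
    inj₂ (suc i , ≤-<-trans i<bot bottom<N , >⇒≢ (s≤s (<⇒≤ top<i)) , β-shift i (<⇒≤ top<i) i<bot)

  β-shift⁻¹ : ∀ i → top < i → i ≤ bottom → ∃ λ j → j < N × j ≢ bottom × β P N i ≡ β Q N j
  β-shift⁻¹ (suc j) top<i i≤bot =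
    j , <-trans (n<1+n j) (≤-<-trans i≤bot bottom<N) , <⇒≢ i≤bot , sym (β-shift j (≤-pred top<i) i≤bot)

  β-image-P : ∀ i → i < N → i ≡ top ⊎ ∃ λ j → j < N × j ≢ bottom × β P N i ≡ β Q N j
  β-image-P i i<N with <-cmp i top | bottom <? i
  ... | tri≈ _ i≡top _ | _ = inj₁ i≡top
  ... | tri< i<top _ _ | _ =
    inj₂ (i , i<N , <⇒≢ (<-≤-trans i<top top≤bottom) , cong (_+ (N ∸ suc i)) (sym (Q≡P-above i i<top)))
  ... | tri> _ _ _ | yes bot<i = inj₂ (i , i<N , >⇒≢ bot<i , cong (_+ (N ∸ suc i)) (sym (Q≡P-below i bot<i)))
  ... | tri> _ _ top<i | no bot≮i = inj₂ (β-shift⁻¹ i top<i (≮⇒≥ bot≮i))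

module BeadMoveOfShape {P Q : ℕ → ℕ} {N : ℕ} (shape : HookShape P Q N)
  (P-suc : ∀ i → P (suc i) ≤ P i) (Q-suc : ∀ i → Q (suc i) ≤ Q i) where

  open HookShape shape

  x d : ℕ
  x = β P N top
  d = skewSize P Q N

  d≤x : d ≤ x
  d≤x = subst (d ≤_) β-moved (m≤n+m d (β Q N bottom))

  x∸d≡ : x ∸ d ≡ β Q N bottom
  x∸d≡ = trans (cong (_∸ d) (sym β-moved)) (m+n∸n≡m (β Q N bottom) d)

  x∸d<x : x ∸ d < x
  x∸d<x = begin-strict
    x ∸ d              ≡⟨ x∸d≡ ⟩
    β Q N bottom       <⟨ +-monoˡ-< (N ∸ suc bottom) Q<P-bottom ⟩
    β P N bottom       ≤⟨ β-antitone P N P-suc top≤bottom bottom<N ⟩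
    x                  ∎
    where open ≤-Reasoning

  occupied-P-x : occupied (β P N) N x ≡ true
  occupied-P-x = occupied-intro (β P N) N x top (≤-<-trans top≤bottom bottom<N) refl

  occupied-Q-x∸d : occupied (β Q N) N (x ∸ d) ≡ true
  occupied-Q-x∸d = occupied-intro (β Q N) N (x ∸ d) bottom bottom<N (sym x∸d≡)

  vacant-Q-x : occupied (β Q N) N x ≡ false
  vacant-Q-x = occupied-false (β Q N) N x λ i i<N βQi≡x → case β-image-Q i i<N of λ where
    (inj₁ refl) → <-irrefl (trans x∸d≡ βQi≡x) x∸d<x
    (inj₂ (j , j<N , j≢top , βQi≡βPj)) →
      j≢top (β-injective P N P-suc j<N (≤-<-trans top≤bottom bottom<N) (trans (sym βQi≡βPj) βQi≡x))

  vacant-P-x∸d : occupied (β P N) N (x ∸ d) ≡ false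
  vacant-P-x∸d = occupied-false (β P N) N (x ∸ d) λ i i<N βPi≡x∸d → case β-image-P i i<N of λ where
    (inj₁ refl) → <-irrefl (sym βPi≡x∸d) x∸d<x
    (inj₂ (j , j<N , j≢bot , βPi≡βQj)) →
      j≢bot (β-injective Q N Q-suc j<N bottom<N (trans (sym βPi≡βQj) (trans βPi≡x∸d x∸d≡)))

  same-elsewhere : ∀ y → y ≢ x → y ≢ x ∸ d → occupied (β P N) N y ≡ occupied (β Q N) N y
  same-elsewhere y y≢x y≢x∸d = occupied-≡ (β P N) (β Q N) N y P→Q Q→P
    where
    P→Q : ∀ i → i < N → β P N i ≡ y → ∃ λ j → j < N × β Q N j ≡ y
    P→Q i i<N βPi≡y with β-image-P i i<N
    ... | inj₁ refl = ⊥-elim (y≢x (sym βPi≡y))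
    ... | inj₂ (j , j<N , _ , βPi≡βQj) = j , j<N , trans (sym βPi≡βQj) βPi≡y
    Q→P : ∀ i → i < N → β Q N i ≡ y → ∃ λ j → j < N × β P N j ≡ y
    Q→P i i<N βQi≡y with β-image-Q i i<N
    ... | inj₁ refl = ⊥-elim (y≢x∸d (trans (sym βQi≡y) (sym x∸d≡)))
    ... | inj₂ (j , j<N , _ , βQi≡βPj) = j , j<N , trans (sym βQi≡βPj) βQi≡y

rowCells : ℕ → ℕ → ℕ → List Node
rowCells i a zero    = []
rowCells i a (suc k) = (i , a) ∷ rowCells i (suc a) k

∈-rowCells⁻ : ∀ {i' j} i a k → (i' , j) ∈ rowCells i a k → i' ≡ i × a ≤ j × j < a + k
∈-rowCells⁻ i a (suc k) (here refl) = refl , ≤-refl , subst (a <_) (sym (+-suc a k)) (s≤s (m≤m+n a k))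
∈-rowCells⁻ {j = j} i a (suc k) (there c∈) with ∈-rowCells⁻ i (suc a) k c∈
... | refl , a<j , j<a+1+k = refl , <⇒≤ a<j , subst (j <_) (sym (+-suc a k)) j<a+1+k

∈-rowCells⁺ : ∀ i a k j → a ≤ j → j < a + k → (i , j) ∈ rowCells i a k
∈-rowCells⁺ i a zero    j a≤j j<a+0 = ⊥-elim (<-irrefl refl (≤-<-trans a≤j (subst (j <_) (+-identityʳ a) j<a+0)))
∈-rowCells⁺ i a (suc k) j a≤j j<a+k with a ≟ j
... | yes refl = here refl
... | no a≢j   = there (∈-rowCells⁺ i (suc a) k j (≤∧≢⇒< a≤j a≢j) (subst (j <_) (+-suc a k) j<a+k))

rowCells-unique : ∀ i a k → Unique (rowCells i a k)
rowCells-unique i a zero    = []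
rowCells-unique i a (suc k) =
  All.tabulate (λ c∈ c≡ → <-irrefl (cong proj₂ c≡) (proj₁ (proj₂ (∈-rowCells⁻ i (suc a) k c∈))))
  ∷ rowCells-unique i (suc a) k

length-rowCells : ∀ i a k → length (rowCells i a k) ≡ k
length-rowCells i a zero    = refl
length-rowCells i a (suc k) = cong suc (length-rowCells i (suc a) k)

skewCells : (P Q : ℕ → ℕ) → ℕ → List Node
skewCells P Q zero    = []
skewCells P Q (suc n) = skewCells P Q n ++ rowCells n (Q n) (P n ∸ Q n)

module _ (P Q : ℕ → ℕ) (Q≤P : ∀ i → Q i ≤ P i) where

  ∈-skewCells⁻ : ∀ n {i j} → (i , j) ∈ skewCells P Q n → i < n × Q i ≤ j × j < P i
  ∈-skewCells⁻ (suc n) c∈ with ∈-++⁻ (skewCells P Q n) c∈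
  ... | inj₁ c∈' with ∈-skewCells⁻ n c∈'
  ...   | i<n , in-row = m<n⇒m<1+n i<n , in-row
  ∈-skewCells⁻ (suc n) {j = j} c∈ | inj₂ c∈' with ∈-rowCells⁻ n (Q n) (P n ∸ Q n) c∈'
  ... | refl , Qn≤j , j<Pn = ≤-refl , Qn≤j , subst (j <_) (m+[n∸m]≡n (Q≤P n)) j<Pn

  ∈-skewCells⁺ : ∀ n i j → i < n → Q i ≤ j → j < P i → (i , j) ∈ skewCells P Q n
  ∈-skewCells⁺ (suc n) i j i<1+n Qi≤j j<Pi with i ≟ n
  ... | yes refl = ∈-++⁺ʳ (skewCells P Q n)
                     (∈-rowCells⁺ i (Q i) (P i ∸ Q i) j Qi≤j (subst (j <_) (sym (m+[n∸m]≡n (Q≤P i))) j<Pi))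
  ... | no i≢n   = ∈-++⁺ˡ (∈-skewCells⁺ n i j (≤∧≢⇒< (≤-pred i<1+n) i≢n) Qi≤j j<Pi)

  skewCells-unique : ∀ n → Unique (skewCells P Q n)
  skewCells-unique zero    = []
  skewCells-unique (suc n) = Unique.++⁺ (skewCells-unique n) (rowCells-unique n (Q n) (P n ∸ Q n))
    (λ (c∈skew , c∈row) → <-irrefl (proj₁ (∈-rowCells⁻ n (Q n) _ c∈row)) (proj₁ (∈-skewCells⁻ n c∈skew)))

length-skewCells : ∀ P Q n → length (skewCells P Q n) ≡ skewSize P Q n
length-skewCells P Q zero    = refl
length-skewCells P Q (suc n) =
  trans (length-++ (skewCells P Q n)) (cong₂ _+_ (length-skewCells P Q n) (length-rowCells n (Q n) (P n ∸ Q n)))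

Adjacent-sym : ∀ {c d} → Adjacent c d → Adjacent d c
Adjacent-sym (inj₁ (e , inj₁ j+1≡j')) = inj₁ (sym e , inj₂ j+1≡j')
Adjacent-sym (inj₁ (e , inj₂ j'+1≡j)) = inj₁ (sym e , inj₁ j'+1≡j)
Adjacent-sym (inj₂ (e , inj₁ i+1≡i')) = inj₂ (sym e , inj₂ i+1≡i')
Adjacent-sym (inj₂ (e , inj₂ i'+1≡i)) = inj₂ (sym e , inj₁ i'+1≡i)

PathIn-++ : ∀ {H c d e} → PathIn H c d → PathIn H d e → PathIn H c e
PathIn-++ here            q = q
PathIn-++ (step a d∈ p) q = step a d∈ (PathIn-++ p q)

PathIn-reverse : ∀ {H c d} → c ∈ H → PathIn H c d → PathIn H d c
PathIn-reverse c∈ p = go c∈ p here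
  where
  go : ∀ {H c d e} → c ∈ H → PathIn H c d → PathIn H c e → PathIn H d e
  go c∈ here           acc = acc
  go c∈ (step a c'∈ p) acc = go c'∈ p (step (Adjacent-sym a) c∈ acc)

connected-via : ∀ {H} b → (∀ {c} → c ∈ H → PathIn H c b) → Connected H
connected-via b to-b c∈ d∈ = PathIn-++ (to-b c∈) (PathIn-reverse d∈ (to-b d∈))

PathIn-rows≤ : ∀ {H} i → (∀ j → (i , j) ∈ H → (suc i , j) ∈ H → ⊥) →
  ∀ {c d} → c ∈ H → proj₁ c ≤ i → PathIn H c d → proj₁ d ≤ i
PathIn-rows≤ i no-edge c∈ c≤i here = c≤i
PathIn-rows≤ i no-edge c∈ c≤i (step (inj₁ (refl , _)) c'∈ p) = PathIn-rows≤ i no-edge c'∈ c≤i p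
PathIn-rows≤ i no-edge c∈ c≤i (step (inj₂ (refl , inj₂ refl)) c'∈ p) =
  PathIn-rows≤ i no-edge c'∈ (≤-trans (n≤1+n _) c≤i) p
PathIn-rows≤ i no-edge {a , b} c∈ a≤i (step (inj₂ (refl , inj₁ refl)) c'∈ p) with a ≟ i
... | yes refl = ⊥-elim (no-edge b c∈ c'∈)
... | no a≢i   = PathIn-rows≤ i no-edge c'∈ (≤∧≢⇒< a≤i a≢i) p

module HookCells {P Q : ℕ → ℕ} {N : ℕ} (shape : HookShape P Q N) (Q-suc : ∀ i → Q (suc i) ≤ Q i) where

  open HookShape shape

  cells : List Node
  cells = skewCells P Q N

  ∈-cells⁻ : ∀ {i j} → (i , j) ∈ cells → i < N × Q i ≤ j × j < P i
  ∈-cells⁻ = ∈-skewCells⁻ P Q Q≤P N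

  ∈-cells⁺ : ∀ {i j} → i < N → Q i ≤ j → j < P i → (i , j) ∈ cells
  ∈-cells⁺ = ∈-skewCells⁺ P Q Q≤P N _ _

  walk-left : ∀ i j → Q i ≤ j → (i , j) ∈ cells → PathIn cells (i , j) (i , Q i)
  walk-left i zero    Qi≤0 _ = subst (λ q → PathIn cells (i , 0) (i , q)) (sym (n≤0⇒n≡0 Qi≤0)) here
  walk-left i (suc j) Qi≤j+1 c∈ with Q i ≟ suc j
  ... | yes Qi≡j+1 = subst (λ q → PathIn cells (i , suc j) (i , q)) (sym Qi≡j+1) here
  ... | no Qi≢j+1  = step (inj₁ (refl , inj₂ refl)) left∈ (walk-left i j Qi≤j left∈)
    where
    Qi≤j : Q i ≤ j
    Qi≤j = ≤-pred (≤∧≢⇒< Qi≤j+1 Qi≢j+1)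
    left∈ : (i , j) ∈ cells
    left∈ = let (i<N , _ , j+1<Pi) = ∈-cells⁻ c∈ in ∈-cells⁺ i<N Qi≤j (<-trans (n<1+n j) j+1<Pi)

  walk-down : ∀ d i → top ≤ i → i + d ≡ bottom → PathIn cells (i , Q i) (bottom , Q bottom)
  walk-down zero    i _     i+0≡bot =
    subst (λ b → PathIn cells (i , Q i) (b , Q b)) (trans (sym (+-identityʳ i)) i+0≡bot) here
  walk-down (suc d) i top≤i i+d+1≡bot =
    step (inj₂ (refl , inj₁ refl)) below∈
      (PathIn-++ (walk-left (suc i) (Q i) (Q-suc i) below∈)
                 (walk-down d (suc i) (≤-trans top≤i (n≤1+n i)) (trans (sym (+-suc i d)) i+d+1≡bot)))
    where
    i<bot : i < bottom
    i<bot = subst (i <_) i+d+1≡bot (subst (_≤ i + suc d) (+-comm i 1) (+-monoʳ-≤ i (s≤s z≤n)))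
    below∈ : (suc i , Q i) ∈ cells
    below∈ = ∈-cells⁺ (≤-<-trans i<bot bottom<N) (Q-suc i) (subst (Q i <_) (sym (joined i top≤i i<bot)) ≤-refl)

  connected : Connected cells
  connected = connected-via (bottom , Q bottom) to-bottom
    where
    to-bottom : ∀ {c} → c ∈ cells → PathIn cells c (bottom , Q bottom)
    to-bottom {i , j} c∈ =
      let (_ , Qi≤j , j<Pi) = ∈-cells⁻ c∈
          (top≤i , i≤bot) = rows i (≤-<-trans Qi≤j j<Pi)
      in PathIn-++ (walk-left i j Qi≤j c∈) (walk-down (bottom ∸ i) i top≤i (m+[n∸m]≡n i≤bot))

  on-rim : ∀ i j → Q i ≤ j → j < P i → ¬ suc j < P (suc i)
  on-rim i j Qi≤j j<Pi j+1<Pi+1 with rows i (≤-<-trans Qi≤j j<Pi)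
  ... | top≤i , i≤bot with m≤n⇒m<n∨m≡n i≤bot
  ...   | inj₁ i<bot = <-irrefl refl (<-≤-trans j+1<Pi+1 (subst (_≤ suc j) (sym (joined i top≤i i<bot)) (s≤s Qi≤j)))
  ...   | inj₂ refl  = <-irrefl refl (<-≤-trans j+1<Pi+1 (begin
          P (suc i)  ≡⟨ Q≡P-below (suc i) ≤-refl ⟨
          Q (suc i)  ≤⟨ Q-suc i ⟩
          Q i        ≤⟨ Qi≤j ⟩
          j          ≤⟨ n≤1+n j ⟩
          suc j      ∎))
    where open ≤-Reasoning

rimHook-of-shape : ∀ {Q N} (lam mu : Partition) → length (proj₁ lam) ≤ N → (∀ i → part (proj₁ mu) i ≡ Q i) →
  HookShape (part (proj₁ lam)) Q N → RemoveRimHook (skewSize (part (proj₁ lam)) Q N) lam mu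
rimHook-of-shape {Q} {N} lam mu len≤N mu≡Q shape =
  cells , skewCells-unique P Q Q≤P N , length-skewCells P Q N , All.tabulate in-rim , connected , diagram
  where
  open HookShape shape using (Q≤P)
  P : ℕ → ℕ
  P = part (proj₁ lam)
  Q-suc : ∀ i → Q (suc i) ≤ Q i
  Q-suc i = subst₂ _≤_ (mu≡Q (suc i)) (mu≡Q i) (part-suc-≤ (proj₁ (proj₂ mu)) i)
  open HookCells shape Q-suc
  in-rim : ∀ {c} → c ∈ cells → InRim lam c
  in-rim {i , j} c∈ = let (_ , Qi≤j , j<Pi) = ∈-cells⁻ c∈ in j<Pi , on-rim i j Qi≤j j<Pi
  diagram : ∀ c → (InDiagram mu c → InDiagram lam c × ¬ c ∈ cells) × (InDiagram lam c × ¬ c ∈ cells → InDiagram mu c)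
  diagram (i , j) = removed , kept
    where
    removed : j < part (proj₁ mu) i → j < P i × ¬ (i , j) ∈ cells
    removed j<mui = <-≤-trans j<Qi (Q≤P i) , λ c∈ → <-irrefl refl (<-≤-trans j<Qi (proj₁ (proj₂ (∈-cells⁻ c∈))))
      where
      j<Qi : j < Q i
      j<Qi = subst (j <_) (mu≡Q i) j<mui
    kept : j < P i × ¬ (i , j) ∈ cells → j < part (proj₁ mu) i
    kept (j<Pi , c∉) with j <? Q i
    ... | yes j<Qi = subst (j <_) (sym (mu≡Q i)) j<Qi
    ... | no j≮Qi  = ⊥-elim (c∉ (∈-cells⁺ i<N (≮⇒≥ j≮Qi) j<Pi))
      where
      i<N : i < N
      i<N = <-≤-trans (part-pos⇒<length (proj₁ lam) i (≤-<-trans z≤n j<Pi)) len≤N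

module ShapeOfRimHook {s : ℕ} .{{_ : NonZero s}} (lam mu : Partition) (N : ℕ) (len≤N : length (proj₁ lam) ≤ N)
  (hook : RemoveRimHook s lam mu) where

  P Q : ℕ → ℕ
  P = part (proj₁ lam)
  Q = part (proj₁ mu)

  H : List Node
  H = proj₁ hook
  H! : Unique H
  H! = proj₁ (proj₂ hook)
  length-H : length H ≡ s
  length-H = proj₁ (proj₂ (proj₂ hook))
  H-rim : All (InRim lam) H
  H-rim = proj₁ (proj₂ (proj₂ (proj₂ hook)))
  H-connected : Connected H
  H-connected = proj₁ (proj₂ (proj₂ (proj₂ (proj₂ hook))))
  diagram : ∀ c → (InDiagram mu c → InDiagram lam c × ¬ c ∈ H) × (InDiagram lam c × ¬ c ∈ H → InDiagram mu c)
  diagram = proj₂ (proj₂ (proj₂ (proj₂ (proj₂ hook))))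

  Q-suc : ∀ i → Q (suc i) ≤ Q i
  Q-suc = part-suc-≤ (proj₁ (proj₂ mu))

  Q≤P : ∀ i → Q i ≤ P i
  Q≤P i with Q i ≤? P i
  ... | yes Qi≤Pi = Qi≤Pi
  ... | no Qi≰Pi  = ⊥-elim (<-irrefl refl (proj₁ (proj₁ (diagram (i , P i)) (≰⇒> Qi≰Pi))))

  ∈H⁻ : ∀ {i j} → (i , j) ∈ H → Q i ≤ j × j < P i
  ∈H⁻ {i} {j} c∈ with Q i ≤? j
  ... | yes Qi≤j = Qi≤j , proj₁ (All.lookup H-rim c∈)
  ... | no Qi≰j  = ⊥-elim (proj₂ (proj₁ (diagram (i , j)) (≰⇒> Qi≰j)) c∈)

  ∈H⁺ : ∀ {i j} → Q i ≤ j → j < P i → (i , j) ∈ H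
  ∈H⁺ {i} {j} Qi≤j j<Pi with (i , j) ∈? H
  ... | yes c∈ = c∈
  ... | no c∉  = ⊥-elim (<-irrefl refl (≤-<-trans Qi≤j (proj₂ (diagram (i , j)) (j<Pi , c∉))))

  row<N : ∀ {i j} → j < P i → i < N
  row<N j<Pi = <-≤-trans (part-pos⇒<length (proj₁ lam) _ (≤-<-trans z≤n j<Pi)) len≤N

  skewSize≡ : skewSize P Q N ≡ s
  skewSize≡ = begin
    skewSize P Q N                ≡⟨ length-skewCells P Q N ⟨
    length (skewCells P Q N)      ≡⟨ Unique-length-≡ (skewCells-unique P Q Q≤P N) H! (mk⇔ to from) ⟩
    length H                      ≡⟨ length-H ⟩
    s                             ∎
    where
    open ≡-Reasoning
    to : ∀ {c} → c ∈ skewCells P Q N → c ∈ H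
    to c∈ = let (_ , Qi≤j , j<Pi) = ∈-skewCells⁻ P Q Q≤P N c∈ in ∈H⁺ Qi≤j j<Pi
    from : ∀ {c} → c ∈ H → c ∈ skewCells P Q N
    from {i , j} c∈ = let (Qi≤j , j<Pi) = ∈H⁻ c∈ in ∈-skewCells⁺ P Q Q≤P N i j (row<N j<Pi) Qi≤j j<Pi

  Touched : ℕ → Set
  Touched i = Q i < P i

  touched-rim : ∀ i → Touched i → P (suc i) ≤ suc (Q i)
  touched-rim i Ri = ≮⇒≥ (proj₂ (All.lookup H-rim (∈H⁺ ≤-refl Ri)))

  -- H is connected, so some column of H meets both row i and row i + 1.
  touched-joined : ∀ i k → Touched i → Touched k → i < k → Q i < P (suc i)
  touched-joined i k Ri Rk i<k with Q i <? P (suc i)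
  ... | yes Qi<Pi+1 = Qi<Pi+1
  ... | no Qi≮Pi+1 = ⊥-elim (<-irrefl refl (<-≤-trans i<k
          (PathIn-rows≤ i no-edge (∈H⁺ ≤-refl Ri) ≤-refl (H-connected (∈H⁺ ≤-refl Ri) (∈H⁺ ≤-refl Rk)))))
    where
    no-edge : ∀ j → (i , j) ∈ H → (suc i , j) ∈ H → ⊥
    no-edge j c∈ c'∈ = Qi≮Pi+1 (≤-<-trans (proj₁ (∈H⁻ c∈)) (proj₂ (∈H⁻ c'∈)))

  touched-between : ∀ {i j k} → Touched i → Touched k → i ≤ j → j ≤ k → Touched j
  touched-between {i} {j} {k} Ri Rk i≤j j≤k with m≤n⇒∃[o]m+o≡n i≤j
  ... | d , refl = go d i Ri j≤k
    where
    go : ∀ d i → Touched i → i + d ≤ k → Touched (i + d)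
    go zero    i Ri _ rewrite +-identityʳ i = Ri
    go (suc d) i Ri i+d+1≤k = subst Touched (sym (+-suc i d))
      (go d (suc i) (≤-<-trans (Q-suc i) (touched-joined i k Ri Rk i<k)) (subst (_≤ k) (+-suc i d) i+d+1≤k))
      where
      i<k : i < k
      i<k = <-≤-trans (s≤s (m≤m+n i d)) (subst (_≤ k) (+-suc i d) i+d+1≤k)

  some-touched : ∃ Touched
  some-touched with ∈-of-length-pos H (subst (0 <_) (sym length-H) (>-nonZero⁻¹ s))
  ... | (i , j) , c∈ = i , uncurry ≤-<-trans (∈H⁻ c∈)

  shape : HookShape P Q N
  shape with some-touched
  ... | i₀ , R-i₀ with least (λ i → Q i <? P i) i₀ R-i₀ | greatest (λ i → Q i <? P i) N (λ _ → row<N) i₀ R-i₀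
  ... | top , top≤i₀ , R-top , top-least | bottom , i₀≤bottom , R-bottom , bottom-greatest = record
    { top         = top
    ; bottom      = bottom
    ; top≤bottom  = ≤-trans top≤i₀ i₀≤bottom
    ; bottom<N    = row<N R-bottom
    ; Q≤P         = Q≤P
    ; Q<P-bottom  = R-bottom
    ; Q≡P-above   = λ i i<top → ≤-antisym (Q≤P i) (≮⇒≥ (top-least i i<top))
    ; Q≡P-below   = λ i bot<i → ≤-antisym (Q≤P i) (≮⇒≥ (bottom-greatest i bot<i))
    ; joined      = λ i top≤i i<bot → let Ri = touched-between R-top R-bottom top≤i (<⇒≤ i<bot) in
                      ≤-antisym (touched-rim i Ri) (touched-joined i bottom Ri R-bottom i<bot)
    }

  size≡ : size lam ≡ size mu + s
  size≡ = trans (size-∸ lam mu N len≤N Q≤P) (cong (size mu +_) skewSize≡)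

  length-mu≤N : length (proj₁ mu) ≤ N
  length-mu≤N = ≤-trans (length-mono (proj₁ mu) (proj₁ lam) Q≤P (proj₂ (proj₂ mu))) len≤N

module ShapeOfBeadMove {s : ℕ} .{{_ : NonZero s}} (kap : Partition) (N : ℕ) (len≤N : length (proj₁ kap) ≤ N)
  (x : ℕ) (s≤x : s ≤ x) (bead : occupied (β (part (proj₁ kap)) N) N x ≡ true)
  (gap : occupied (β (part (proj₁ kap)) N) N (x ∸ s) ≡ false) where

  P : ℕ → ℕ
  P = part (proj₁ kap)

  P-suc : ∀ i → P (suc i) ≤ P i
  P-suc = part-suc-≤ (proj₁ (proj₂ kap))

  P-beyond : ∀ i → N ≤ i → P i ≡ 0
  P-beyond i N≤i = part-beyond (proj₁ kap) i (≤-trans len≤N N≤i)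

  z : ℕ
  z = x ∸ s

  z<x : z < x
  z<x = ∸-monoʳ-< (>-nonZero⁻¹ s) s≤x

  top : ℕ
  top = proj₁ (occupied-elim (β P N) N x bead)

  β-top : β P N top ≡ x
  β-top = proj₂ (proj₂ (occupied-elim (β P N) N x bead))

  above-z<N : ∀ i → z < β P N i → i < N
  above-z<N i z<βi with i <? N
  ... | yes i<N = i<N
  ... | no i≮N  = ⊥-elim (n≮0 (<-≤-trans z<βi (≤-reflexive
        (cong₂ _+_ (P-beyond i (≮⇒≥ i≮N)) (m≤n⇒m∸n≡0 (≤-trans (≮⇒≥ i≮N) (n≤1+n i)))))))

  bottom-search : ∃ λ m → top ≤ m × z < β P N m × (∀ j → m < j → ¬ z < β P N j)
  bottom-search = greatest (λ i → z <? β P N i) N above-z<N top (subst (z <_) (sym β-top) z<x)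

  bottom : ℕ
  bottom = proj₁ bottom-search

  top≤bottom : top ≤ bottom
  top≤bottom = proj₁ (proj₂ bottom-search)

  z<β-bottom : z < β P N bottom
  z<β-bottom = proj₁ (proj₂ (proj₂ bottom-search))

  bottom<N : bottom < N
  bottom<N = above-z<N bottom z<β-bottom

  β<z-below : ∀ j → bottom < j → j < N → β P N j < z
  β<z-below j bot<j j<N with <-cmp (β P N j) z
  ... | tri< βj<z _ _ = βj<z
  ... | tri≈ _ βj≡z _ = ⊥-elim (true≢false (trans (sym (occupied-intro (β P N) N z j j<N βj≡z)) gap))
    where
    true≢false : true ≢ false
    true≢false ()
  ... | tri> _ _ z<βj = ⊥-elim (proj₂ (proj₂ (proj₂ bottom-search)) j bot<j z<βj)

  c : ℕ
  c = N ∸ suc bottom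

  next-row-fits : P (suc bottom) + c ≤ z
  next-row-fits with suc bottom <? N
  ... | yes bot+1<N = begin
    P (suc bottom) + c                             ≡⟨ cong (P (suc bottom) +_) (∸-suc N bottom bot+1<N) ⟩
    P (suc bottom) + suc (N ∸ suc (suc bottom))    ≡⟨ +-suc _ _ ⟩
    suc (β P N (suc bottom))                       ≤⟨ β<z-below (suc bottom) ≤-refl bot+1<N ⟩
    z                                              ∎
    where open ≤-Reasoning
  ... | no bot+1≮N rewrite P-beyond (suc bottom) (≮⇒≥ bot+1≮N) | m≤n⇒m∸n≡0 (≮⇒≥ bot+1≮N) = z≤n

  c≤z : c ≤ z
  c≤z = ≤-trans (m≤n+m c _) next-row-fits

  z∸c<P-bottom : z ∸ c < P bottom
  z∸c<P-bottom = +-cancelʳ-< c (z ∸ c) (P bottom) (subst (_< P bottom + c) (sym (m∸n+n≡m c≤z)) z<β-bottom)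

  P-pos : ∀ i → i ≤ bottom → 0 < P i
  P-pos i i≤bot = <-≤-trans (≤-<-trans z≤n z∸c<P-bottom) (antitone P P-suc i≤bot)

  -- Rows top, ..., bottom - 1 of Q end one column before the next row of P, row bottom is cut so that
  -- its β-number becomes z, and all other rows are those of P.
  Q : ℕ → ℕ
  Q i with <-cmp i bottom
  ... | tri> _ _ _ = P i
  ... | tri≈ _ _ _ = z ∸ c
  ... | tri< _ _ _ with i <? top
  ...   | yes _ = P i
  ...   | no _  = pred (P (suc i))

  Q-below : ∀ i → bottom < i → Q i ≡ P i
  Q-below i bot<i with <-cmp i bottom
  ... | tri> _ _ _      = refl
  ... | tri≈ _ i≡bot _  = ⊥-elim (>⇒≢ bot<i i≡bot)
  ... | tri< i<bot _ _  = ⊥-elim (<-asym i<bot bot<i)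

  Q-bottom : Q bottom ≡ z ∸ c
  Q-bottom with <-cmp bottom bottom
  ... | tri> _ b≢b _ = ⊥-elim (b≢b refl)
  ... | tri≈ _ _ _   = refl
  ... | tri< _ b≢b _ = ⊥-elim (b≢b refl)

  Q-above : ∀ i → i < top → Q i ≡ P i
  Q-above i i<top with <-cmp i bottom
  ... | tri> _ _ bot<i  = ⊥-elim (<-asym i<top (≤-<-trans top≤bottom bot<i))
  ... | tri≈ _ i≡bot _  = ⊥-elim (<⇒≢ (<-≤-trans i<top top≤bottom) i≡bot)
  ... | tri< _ _ _ with i <? top
  ...   | yes _     = refl
  ...   | no i≮top  = ⊥-elim (i≮top i<top)

  Q-between : ∀ i → top ≤ i → i < bottom → Q i ≡ pred (P (suc i))
  Q-between i top≤i i<bot with <-cmp i bottom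
  ... | tri> _ _ bot<i  = ⊥-elim (<-asym i<bot bot<i)
  ... | tri≈ _ i≡bot _  = ⊥-elim (<⇒≢ i<bot i≡bot)
  ... | tri< _ _ _ with i <? top
  ...   | yes i<top = ⊥-elim (<⇒≱ i<top top≤i)
  ...   | no _      = refl

  data Region (i : ℕ) : Set where
    above   : i < top → Region i
    between : top ≤ i → i < bottom → Region i
    at      : i ≡ bottom → Region i
    below   : bottom < i → Region i

  region : ∀ i → Region i
  region i with i <? top | <-cmp i bottom
  ... | yes i<top | _              = above i<top
  ... | no i≮top  | tri< i<bot _ _ = between (≮⇒≥ i≮top) i<bot
  ... | no _      | tri≈ _ i≡bot _ = at i≡bot
  ... | no _      | tri> _ _ bot<i = below bot<i

  pred-P<P : ∀ i → i < bottom → pred (P (suc i)) < P i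
  pred-P<P i i<bot = <-≤-trans (pred-mono-< {{>-nonZero (P-pos (suc i) i<bot)}} (n<1+n (P (suc i)))) (P-suc i)

  Q<P : ∀ i → top ≤ i → i ≤ bottom → Q i < P i
  Q<P i top≤i i≤bot with m≤n⇒m<n∨m≡n i≤bot
  ... | inj₁ i<bot = subst (_< P i) (sym (Q-between i top≤i i<bot)) (pred-P<P i i<bot)
  ... | inj₂ refl  = subst (_< P i) (sym Q-bottom) z∸c<P-bottom

  Q≤P : ∀ i → Q i ≤ P i
  Q≤P i with region i
  ... | above i<top           = ≤-reflexive (Q-above i i<top)
  ... | between top≤i i<bot   = <⇒≤ (Q<P i top≤i (<⇒≤ i<bot))
  ... | at refl               = <⇒≤ (Q<P i top≤bottom ≤-refl)
  ... | below bot<i           = ≤-reflexive (Q-below i bot<i)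

  Q-suc : ∀ i → Q (suc i) ≤ Q i
  Q-suc i with region i
  ... | above i<top = begin
    Q (suc i)   ≤⟨ Q≤P (suc i) ⟩
    P (suc i)   ≤⟨ P-suc i ⟩
    P i         ≡⟨ Q-above i i<top ⟨
    Q i         ∎
    where open ≤-Reasoning
  ... | between top≤i i<bot = begin
    Q (suc i)           ≤⟨ pred-mono-≤ (Q<P (suc i) (≤-trans top≤i (n≤1+n i)) i<bot) ⟩
    pred (P (suc i))    ≡⟨ Q-between i top≤i i<bot ⟨
    Q i                 ∎
    where open ≤-Reasoning
  ... | at refl = begin
    Q (suc bottom)   ≡⟨ Q-below (suc bottom) ≤-refl ⟩
    P (suc bottom)   ≤⟨ m+n≤o⇒m≤o∸n (P (suc bottom)) next-row-fits ⟩
    z ∸ c            ≡⟨ Q-bottom ⟨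
    Q bottom         ∎
    where open ≤-Reasoning
  ... | below bot<i = subst₂ _≤_ (sym (Q-below (suc i) (<-trans bot<i (n<1+n i)))) (sym (Q-below i bot<i)) (P-suc i)

  shape : HookShape P Q N
  shape = record
    { top         = top
    ; bottom      = bottom
    ; top≤bottom  = top≤bottom
    ; bottom<N    = bottom<N
    ; Q≤P         = Q≤P
    ; Q<P-bottom  = Q<P bottom top≤bottom ≤-refl
    ; Q≡P-above   = Q-above
    ; Q≡P-below   = Q-below
    ; joined      = λ i top≤i i<bot → trans (sym (suc-pred (P (suc i)) {{>-nonZero (P-pos (suc i) i<bot)}}))
                                            (cong suc (sym (Q-between i top≤i i<bot)))
    }

  skewSize≡ : skewSize P Q N ≡ s
  skewSize≡ = +-cancelˡ-≡ z _ _ (begin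
    z + skewSize P Q N              ≡⟨ cong (_+ skewSize P Q N) β-Q-bottom ⟨
    β Q N bottom + skewSize P Q N   ≡⟨ HookShape.β-moved shape ⟩
    β P N top                       ≡⟨ β-top ⟩
    x                               ≡⟨ m∸n+n≡m s≤x ⟨
    z + s                           ∎)
    where
    open ≡-Reasoning
    β-Q-bottom : β Q N bottom ≡ z
    β-Q-bottom = trans (cong (_+ c) Q-bottom) (m∸n+n≡m c≤z)

  Q-beyond : ∀ i → N ≤ i → Q i ≡ 0
  Q-beyond i N≤i = trans (Q-below i (<-≤-trans bottom<N N≤i)) (P-beyond i N≤i)

  rimHook : RemoveRimHook s kap (partitionOf Q N Q-suc Q-beyond)
  rimHook = subst (λ s → RemoveRimHook s kap (partitionOf Q N Q-suc Q-beyond)) skewSize≡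
    (rimHook-of-shape kap (partitionOf Q N Q-suc Q-beyond) len≤N (part-positivePrefix Q N Q-suc Q-beyond) shape)

partitionΨ : (s N levels : ℕ) → Partition → ℕ
partitionΨ s N levels p = Ψ s levels (occupied (β (part (proj₁ p)) N) N)

Ψ-removeRimHook : ∀ {s} .{{_ : NonZero s}} N levels (lam mu : Partition) → length (proj₁ lam) ≤ N →
  part (proj₁ lam) 0 + N ≤ levels → RemoveRimHook s lam mu →
  partitionΨ s N levels lam ≡ suc (partitionΨ s N levels mu)
Ψ-removeRimHook {s} N levels lam mu len≤N fits hook =
  Ψ-move s levels _ _ x (subst (_≤ x) skewSize≡ d≤x) x<levels
    occupied-P-x (subst (λ y → occupied (β P N) N y ≡ false) x∸d≡x∸s vacant-P-x∸d)
    vacant-Q-x (subst (λ y → occupied (β Q N) N y ≡ true) x∸d≡x∸s occupied-Q-x∸d)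
    (λ y y≢x y≢x∸s → same-elsewhere y y≢x (λ y≡x∸d → y≢x∸s (trans y≡x∸d x∸d≡x∸s)))
  where
  open ShapeOfRimHook lam mu N len≤N hook using (P; Q; Q-suc; shape; skewSize≡)
  open BeadMoveOfShape shape (part-suc-≤ (proj₁ (proj₂ lam))) Q-suc
  open HookShape shape using (top; top≤bottom; bottom<N)
  x∸d≡x∸s : x ∸ d ≡ x ∸ s
  x∸d≡x∸s = cong (x ∸_) skewSize≡
  x<levels : x < levels
  x<levels = <-≤-trans (+-mono-≤-< (antitone P (part-suc-≤ (proj₁ (proj₂ lam))) z≤n)
                                  (∸-monoʳ-< {o = 0} (s≤s z≤n) (≤-<-trans top≤bottom bottom<N))) fits

Ψ-removeHooks : ∀ {s} .{{_ : NonZero s}} N levels {lam kap w} → RemoveHooks s lam kap w →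
  length (proj₁ lam) ≤ N → part (proj₁ lam) 0 + N ≤ levels →
  partitionΨ s N levels lam ≡ w + partitionΨ s N levels kap × length (proj₁ kap) ≤ N
Ψ-removeHooks N levels done len≤N fits = refl , len≤N
Ψ-removeHooks {s} N levels {lam} {kap} {suc w} (next {mu = mu} hook rest) len≤N fits =
  trans (Ψ-removeRimHook N levels lam mu len≤N fits hook) (cong suc (proj₁ Ψ-rest)) , proj₂ Ψ-rest
  where
  open ShapeOfRimHook lam mu N len≤N hook using (Q≤P; length-mu≤N)
  Ψ-rest : partitionΨ s N levels mu ≡ w + partitionΨ s N levels kap × length (proj₁ kap) ≤ N
  Ψ-rest = Ψ-removeHooks N levels rest length-mu≤N (≤-trans (+-monoˡ-≤ N (Q≤P 0)) fits)

Ψ-core : ∀ {s} .{{_ : NonZero s}} N levels kap → HasNoRimHook s kap → length (proj₁ kap) ≤ N →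
  partitionΨ s N levels kap ≡ 0
Ψ-core {s} N levels kap no-hook len≤N with partitionΨ s N levels kap ≟ 0
... | yes Ψ≡0 = Ψ≡0
... | no Ψ≢0 with Ψ-pos s levels _ (n≢0⇒n>0 Ψ≢0)
...   | x , s≤x , bead , gap = ⊥-elim (no-hook (partitionOf Q N Q-suc Q-beyond , rimHook))
  where open ShapeOfBeadMove kap N len≤N x s≤x bead gap using (Q; Q-suc; Q-beyond; rimHook)

weight≡Ψ : ∀ {s} .{{_ : NonZero s}} {lam kap w} → CoreWeight s lam kap w →
  partitionΨ s (length (proj₁ lam)) (part (proj₁ lam) 0 + length (proj₁ lam)) lam ≡ w
weight≡Ψ {s} {lam} {kap} {w} (hooks , no-hook) = begin
  partitionΨ s N L lam        ≡⟨ proj₁ removal ⟩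
  w + partitionΨ s N L kap    ≡⟨ cong (w +_) (Ψ-core N L kap no-hook (proj₂ removal)) ⟩
  w + 0                       ≡⟨ +-identityʳ w ⟩
  w                           ∎
  where
  open ≡-Reasoning
  N L : ℕ
  N = length (proj₁ lam)
  L = part (proj₁ lam) 0 + N
  removal : partitionΨ s N L lam ≡ w + partitionΨ s N L kap × length (proj₁ kap) ≤ N
  removal = Ψ-removeHooks N L hooks ≤-refl ≤-refl

weight-unique : ∀ {s} .{{_ : NonZero s}} {lam kap kap' w w'} →
  CoreWeight s lam kap w → CoreWeight s lam kap' w' → w ≡ w'
weight-unique cw cw' = trans (sym (weight≡Ψ cw)) (weight≡Ψ cw')

size-removeHooks : ∀ {s} .{{_ : NonZero s}} {lam kap w} → RemoveHooks s lam kap w → size lam ≡ size kap + s * w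
size-removeHooks {s} {lam} {w = zero} done = sym (trans (cong (size lam +_) (*-zeroʳ s)) (+-identityʳ (size lam)))
size-removeHooks {s} {lam} {kap} {suc w} (next {mu = mu} hook rest) = begin
  size lam                ≡⟨ ShapeOfRimHook.size≡ lam mu (length (proj₁ lam)) ≤-refl hook ⟩
  size mu + s             ≡⟨ cong (_+ s) (size-removeHooks rest) ⟩
  size kap + s * w + s    ≡⟨ +-assoc (size kap) _ _ ⟩
  size kap + (s * w + s)  ≡⟨ cong (size kap +_) (trans (+-comm (s * w) s) (sym (*-suc s w))) ⟩
  size kap + s * suc w    ∎
  where open ≡-Reasoning

common-core-difference : ∀ {s} .{{_ : NonZero s}} {lam mu kap w w'} →
  CoreWeight s lam kap w → CoreWeight s mu kap w' → size lam ∸ size mu ≡ s * (w ∸ w')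
common-core-difference {s} {lam} {mu} {kap} {w} {w'} (hooks , _) (hooks' , _) = begin
  size lam ∸ size mu                    ≡⟨ cong₂ _∸_ (size-removeHooks hooks) (size-removeHooks hooks') ⟩
  (size kap + s * w) ∸ (size kap + s * w') ≡⟨ [m+n]∸[m+o]≡n∸o (size kap) (s * w) (s * w') ⟩
  s * w ∸ s * w'                        ≡⟨ *-distribˡ-∸ s w w' ⟨
  s * (w ∸ w')                          ∎
  where open ≡-Reasoning

sameCores-smaller⇒weight≥ : ∀ s t .{{_ : NonZero s}} .{{_ : NonZero t}} → Coprime t s → ∀ lam mu →
  SameCore s lam mu → SameCore t lam mu → size mu < size lam → ∀ {kap w} → CoreWeight s lam kap w → t ≤ w
sameCores-smaller⇒weight≥ s t t⊥s lam mu (kap , (w₁ , cw₁) , (w₂ , cw₂)) (_ , (u₁ , cu₁) , (u₂ , cu₂)) mu<lam cw =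
  begin
  t          ≤⟨ ∣⇒≤ {{>-nonZero gap>0}} (coprime-divisor t⊥s (divides (u₁ ∸ u₂) gaps)) ⟩
  w₁ ∸ w₂    ≤⟨ m∸n≤m w₁ w₂ ⟩
  w₁         ≡⟨ weight-unique cw₁ cw ⟩
  _          ∎
  where
  open ≤-Reasoning
  gaps : s * (w₁ ∸ w₂) ≡ (u₁ ∸ u₂) * t
  gaps = trans (sym (common-core-difference cw₁ cw₂)) (trans (common-core-difference cu₁ cu₂) (*-comm t _))
  gap>0 : 0 < w₁ ∸ w₂
  gap>0 = m<n⇒0<n∸m (*-cancelˡ-< s w₂ w₁ (+-cancelˡ-< (size kap) _ _
            (subst₂ _<_ (size-removeHooks (proj₁ cw₂)) (size-removeHooks (proj₁ cw₁)) mu<lam)))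

corollary3p2 : (s t : ℕ) → 1 < s → 1 < t → Coprime s t →
    (lam : Partition) → WeightLess s lam t ⊎ WeightLess t lam s → Minimal s t lam
corollary3p2 s t 1<s 1<t s⊥t lam small-weight (mu , same-s , same-t , mu<lam) = refute small-weight
  where
  instance
    s≢0 : NonZero s
    s≢0 = >-nonZero (<-trans z<s 1<s)
    t≢0 : NonZero t
    t≢0 = >-nonZero (<-trans z<s 1<t)
  refute : WeightLess s lam t ⊎ WeightLess t lam s → ⊥
  refute (inj₁ (_ , w , cw , w<t)) =
    <⇒≱ w<t (sameCores-smaller⇒weight≥ s t (Coprimality.sym s⊥t) lam mu same-s same-t mu<lam cw)
  refute (inj₂ (_ , u , cu , u<s)) =
    <⇒≱ u<s (sameCores-smaller⇒weight≥ t s s⊥t lam mu same-t same-s mu<lam cu)
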